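{- Let $A$ be a finite alphabet, $n$ a positive integer, and $w$ a pseudocyclic universal partial word for $A^n$. Let $f$ be the first window frame of $w$. Then every distinct cyclic shift of $f$ occurs among the window frames of $w$, and all the distinct cyclic shifts of $f$ occur as window frames of $w$ the same number of times.
   Context: A partial word over $A$ is a finite sequence of characters from $A \cup \{\diamond\}$, where $\diamond \notin A$ is a wild-card symbol; a word over $A$ contains no $\diamond$. $A^n$ denotes the set of words of length $n$ over $A$. For $x = x_1\cdots x_n \in A^n$ and a partial word $w = w_1\cdots w_N$, the position $i$ ($0 \le i \le N-n$) covers $x$ if $x_j = w_{i+j}$ for every $1\le j\le n$ with $w_{i+j}\in A$. A universal partial word for $A^n$ is a partial word $w$ such that every word in $A^n$ is covered by exactly one position of $w$. A window of $w$ is a string $w_{i+1}\cdots w_{i+n}$ ($0\le i\le N-n$) of $n$ consecutive characters; the frame of a partial word is obtained by replacing every letter of $A$ by the symbol $\_$, and the window frames of $w$ are the frames of its windows (the first window frame being the frame of $w_1\cdots w_n$). A cyclic shift of a word $f_1\cdots f_n$ is a word $f_{j+1}\cdots f_n f_1\cdots f_j$. A partial word $w$ is pseudocyclic if its first $n-1$ characters are equal, as a string over $A\cup\{\diamond\}$, to its last $n-1$ characters (possibly overlapping). -}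

module Defs where

open import Data.Nat using (ℕ; zero; suc; _+_; _∸_; _≤_; _<_)
open import Data.Fin using (Fin)
open import Data.Bool using (Bool; true; false)
open import Data.Unit using (⊤)
open import Data.Maybe using (Maybe; just; nothing)
open import Data.List using (List; []; _∷_; take; drop; length; filter; upTo; map; _++_)
open import Data.List.Properties using (≡-dec)
import Data.Bool.Properties as BoolP
open import Data.Vec using (Vec; toList)
open import Data.Product using (Σ; _×_; ∃; _,_)
open import Relation.Binary.PropositionalEquality using (_≡_)
open import Data.List.Relation.Binary.Pointwise using (Pointwise)

-- A partial word over the alphabet A = Fin k: `just a` is the letter a,
-- `nothing` is the wild-card ◇.
PartialWord : ℕ → Set
PartialWord k = List (Maybe (Fin k))

-- The window of length n starting at (0-based) position i : w_{i+1} ... w_{i+n}.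
window : ∀ {k} → ℕ → PartialWord k → ℕ → PartialWord k
window n w i = take n (drop i w)

Compatible : ∀ {k} → Maybe (Fin k) → Fin k → Set
Compatible (just b) a = b ≡ a
Compatible nothing  a = ⊤

Covers : ∀ {k n} → PartialWord k → Vec (Fin k) n → ℕ → Set
Covers {k} {n} w x i = (i + n ≤ length w) × Pointwise Compatible (window n w i) (toList x)

Universal : ∀ {k} (n : ℕ) → PartialWord k → Set
Universal {k} n w = (x : Vec (Fin k) n) →
  ∃ λ i → Covers w x i × (∀ j → Covers w x j → j ≡ i)

Pseudocyclic : ∀ {k} (n : ℕ) → PartialWord k → Set
Pseudocyclic n w = take (n ∸ 1) w ≡ drop (length w ∸ (n ∸ 1)) w

-- frames: `true` stands for the symbol _ (a letter), `false` for ◇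
Frame : Set
Frame = List Bool

frameChar : ∀ {k} → Maybe (Fin k) → Bool
frameChar (just _) = true
frameChar nothing  = false

frame : ∀ {k} → PartialWord k → Frame
frame = map frameChar

windowFrame : ∀ {k} → ℕ → PartialWord k → ℕ → Frame
windowFrame n w i = frame (window n w i)

cyclicShift : ℕ → Frame → Frame
cyclicShift j f = drop j f ++ take j f

-- the list of window positions 0, 1, ..., N - n   (meaningful when n ≤ N)
positions : ∀ {k} → ℕ → PartialWord k → List ℕ
positions n w = upTo (suc (length w ∸ n))

occurrences : ∀ {k} → ℕ → PartialWord k → Frame → ℕ
occurrences n w g =
  length (filter (λ i → ≡-dec BoolP._≟_ (windowFrame n w i) g) (positions n w))

-- Pseudocyclicity makes w a linearisation of a cyclic partial word of
-- length L = |w| - n + 1 in which every word of length n is covered at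
-- exactly one position mod L. If positions t and t + n of this cyclic word
-- carried a letter and a wildcard, sliding a window by one step would give
-- a word covered at two positions that differ mod L; so its frame is
-- n-periodic. Consequently the window frame at i + 1 is the cyclic shift by
-- one of the frame at i, and shifting every frame by one merely rotates the
-- L window frames, which preserves multiplicities.
module Submission where

open import Defs
open import Data.Nat using (ℕ; zero; suc; _+_; _*_; _∸_; NonZero; _≤_; _<_; z≤n; s≤s; s≤s⁻¹; _≟_)
open import Data.Nat.Properties
open import Data.Nat.DivMod
open import Data.Nat.Tactic.RingSolver using (solve-∀)
open import Data.Bool using (Bool; false)
import Data.Bool.Properties as Bool
open import Data.Fin using (Fin; zero; suc)
open import Data.Maybe using (Maybe; just; nothing)
open import Data.List using (List; []; _∷_; _∷ʳ_; take; drop; length; filter; upTo; applyUpTo; map; _++_)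
open import Data.List.Properties
  using (≡-dec; ++-conicalʳ; ∷ʳ-injective; applyUpTo-∷ʳ; map-upTo; map-applyUpTo)
open import Data.List.Relation.Binary.Pointwise using (Pointwise; []; _∷_)
open import Data.List.Relation.Binary.Permutation.Propositional using (_↭_; ↭-refl; module PermutationReasoning)
open import Data.List.Relation.Binary.Permutation.Propositional.Properties using (↭-length; filter-↭; ∷↭∷ʳ)
open import Data.Vec using (Vec; toList)
open import Data.Product using (∃; _×_; _,_; proj₁; proj₂)
open import Data.Sum using (inj₁; inj₂)
open import Data.Unit using (tt)
open import Data.Empty using (⊥; ⊥-elim)
open import Function using (_∘_)
open import Relation.Nullary using (Dec; yes; no)
open import Relation.Binary.PropositionalEquality
  using (_≡_; _≢_; refl; sym; trans; cong; cong₂; subst; subst₂; module ≡-Reasoning)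

lookupOr : {A : Set} → A → List A → ℕ → A
lookupOr d []       _       = d
lookupOr d (x ∷ xs) zero    = x
lookupOr d (x ∷ xs) (suc p) = lookupOr d xs p

lookupOr-take : ∀ {A : Set} (d : A) {m q} xs → q < m → lookupOr d (take m xs) q ≡ lookupOr d xs q
lookupOr-take d {suc m}         []       _         = refl
lookupOr-take d {suc m} {zero}  (x ∷ xs) _         = refl
lookupOr-take d {suc m} {suc q} (x ∷ xs) (s≤s q<m) = lookupOr-take d xs q<m

lookupOr-drop : ∀ {A : Set} (d : A) i xs r → lookupOr d (drop i xs) r ≡ lookupOr d xs (i + r)
lookupOr-drop d zero    xs       r = refl
lookupOr-drop d (suc i) []       r = refl
lookupOr-drop d (suc i) (x ∷ xs) r = lookupOr-drop d i xs r

factor : {A : Set} → (ℕ → A) → ℕ → ℕ → List A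
factor u p n = applyUpTo (λ r → u (p + r)) n

take≡applyUpTo : ∀ {A : Set} (d : A) {n} xs → n ≤ length xs → take n xs ≡ applyUpTo (lookupOr d xs) n
take≡applyUpTo d {zero}  xs       _         = refl
take≡applyUpTo d {suc n} (x ∷ xs) (s≤s n≤l) = cong (x ∷_) (take≡applyUpTo d xs n≤l)

take-drop≡factor : ∀ {A : Set} (d : A) i {n} xs → i + n ≤ length xs →
                   take n (drop i xs) ≡ factor (lookupOr d xs) i n
take-drop≡factor d zero    xs       le        = take≡applyUpTo d xs le
take-drop≡factor d (suc i) (x ∷ xs) (s≤s le) = take-drop≡factor d i xs le

applyUpTo-cong : ∀ {A : Set} {f g : ℕ → A} n → (∀ r → r < n → f r ≡ g r) → applyUpTo f n ≡ applyUpTo g n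
applyUpTo-cong zero    _   = refl
applyUpTo-cong (suc n) f≡g = cong₂ _∷_ (f≡g 0 (s≤s z≤n)) (applyUpTo-cong n (λ r r<n → f≡g (suc r) (s≤s r<n)))

take-applyUpTo : ∀ {A : Set} (f : ℕ → A) {j n} → j ≤ n → take j (applyUpTo f n) ≡ applyUpTo f j
take-applyUpTo f {zero}  _         = refl
take-applyUpTo f {suc j} (s≤s j≤n) = cong (f 0 ∷_) (take-applyUpTo (f ∘ suc) j≤n)

drop-applyUpTo : ∀ {A : Set} (f : ℕ → A) {j n} → j ≤ n →
                 drop j (applyUpTo f n) ≡ applyUpTo (λ r → f (j + r)) (n ∸ j)
drop-applyUpTo f {zero}  _         = refl
drop-applyUpTo f {suc j} (s≤s j≤n) = drop-applyUpTo (f ∘ suc) j≤n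

applyUpTo-++ : ∀ {A : Set} (f : ℕ → A) a b → applyUpTo f a ++ applyUpTo (λ r → f (a + r)) b ≡ applyUpTo f (a + b)
applyUpTo-++ f zero    b = refl
applyUpTo-++ f (suc a) b = cong (f 0 ∷_) (applyUpTo-++ (f ∘ suc) a b)

applyUpTo-rotate : ∀ {A : Set} (f : ℕ → A) L → f L ≡ f 0 → applyUpTo (f ∘ suc) L ↭ applyUpTo f L
applyUpTo-rotate f zero    _       = ↭-refl
applyUpTo-rotate f (suc M) fL≡f0 = begin
  applyUpTo (f ∘ suc) (suc M)        ≡⟨ applyUpTo-∷ʳ (f ∘ suc) M ⟨
  applyUpTo (f ∘ suc) M ∷ʳ f (suc M) ↭⟨ ∷↭∷ʳ (f (suc M)) _ ⟨
  f (suc M) ∷ applyUpTo (f ∘ suc) M  ≡⟨ cong (_∷ applyUpTo (f ∘ suc) M) fL≡f0 ⟩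
  applyUpTo f (suc M)                ∎
  where open PermutationReasoning

Pointwise-applyUpTo⁺ : ∀ {A B : Set} {R : A → B → Set} {f g} n →
                       (∀ r → r < n → R (f r) (g r)) → Pointwise R (applyUpTo f n) (applyUpTo g n)
Pointwise-applyUpTo⁺ zero    _   = []
Pointwise-applyUpTo⁺ (suc n) Rfg = Rfg 0 (s≤s z≤n) ∷ Pointwise-applyUpTo⁺ n (λ r r<n → Rfg (suc r) (s≤s r<n))

Pointwise-applyUpTo⁻ : ∀ {A B : Set} {R : A → B → Set} {f g} n →
                       Pointwise R (applyUpTo f n) (applyUpTo g n) → ∀ r → r < n → R (f r) (g r)
Pointwise-applyUpTo⁻ (suc n) (Rfg ∷ _)   zero    _         = Rfg
Pointwise-applyUpTo⁻ (suc n) (_   ∷ Rfg) (suc r) (s≤s r<n) = Pointwise-applyUpTo⁻ n Rfg r r<n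

toVec : {A : Set} → (ℕ → A) → (n : ℕ) → Vec A n
toVec g zero    = Data.Vec.[]
toVec g (suc n) = g 0 Data.Vec.∷ toVec (g ∘ suc) n

toList-toVec : ∀ {A : Set} (g : ℕ → A) n → toList (toVec g n) ≡ applyUpTo g n
toList-toVec g zero    = refl
toList-toVec g (suc n) = cong (g 0 ∷_) (toList-toVec (g ∘ suc) n)

_[_]≔_ : {A : Set} → (ℕ → A) → ℕ → A → ℕ → A
(v [ i ]≔ a) r with r ≟ i
... | yes _ = a
... | no  _ = v r

[]≔-updated : ∀ {A : Set} (v : ℕ → A) i a → (v [ i ]≔ a) i ≡ a
[]≔-updated v i a with i ≟ i
... | yes _   = refl
... | no  i≢i = ⊥-elim (i≢i refl)

[]≔-unchanged : ∀ {A : Set} (v : ℕ → A) {i r} a → r ≢ i → (v [ i ]≔ a) r ≡ v r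
[]≔-unchanged v {i} {r} a r≢i with r ≟ i
... | yes r≡i = ⊥-elim (r≢i r≡i)
... | no  _   = refl

step-invariant⇒constant : ∀ {A : Set} (u : ℕ → A) → (∀ t → u (suc t) ≡ u t) → ∀ t d → u (t + d) ≡ u t
step-invariant⇒constant u step t zero    = cong u (+-identityʳ t)
step-invariant⇒constant u step t (suc d) =
  trans (cong u (+-suc t d)) (trans (step (t + d)) (step-invariant⇒constant u step t d))

periodic-below⇒mod : ∀ {A : Set} (u : ℕ → A) L .{{_ : NonZero L}} N →
                     (∀ q → L + q < N → u (L + q) ≡ u q) → ∀ p → p < N → u p ≡ u (p % L)
periodic-below⇒mod u L N periodic p p<N = begin
  u p                    ≡⟨ cong u p≡[p/L]*L+p%L ⟩
  u (p / L * L + p % L)  ≡⟨ shift-by-multiple (p / L) (p % L) (subst (_< N) p≡[p/L]*L+p%L p<N) ⟩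
  u (p % L)              ∎
  where
  open ≡-Reasoning
  p≡[p/L]*L+p%L : p ≡ p / L * L + p % L
  p≡[p/L]*L+p%L = trans (m≡m%n+[m/n]*n p L) (+-comm (p % L) _)
  shift-by-multiple : ∀ d r → d * L + r < N → u (d * L + r) ≡ u r
  shift-by-multiple zero    r _  = refl
  shift-by-multiple (suc d) r lt = trans (cong u (+-assoc L (d * L) r))
    (trans (periodic (d * L + r) lt′) (shift-by-multiple d r (≤-<-trans (m≤n+m _ L) lt′)))
    where
    lt′ : L + (d * L + r) < N
    lt′ = subst (_< N) (+-assoc L (d * L) r) lt

cyclicShift-factor : ∀ (u : ℕ → Bool) {n} → (∀ t → u (t + n) ≡ u t) →
                     ∀ p {j} → j ≤ n → cyclicShift j (factor u p n) ≡ factor u (p + j) n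
cyclicShift-factor u {n} periodic p {j} j≤n = begin
  drop j (applyUpTo f n) ++ take j (applyUpTo f n)
    ≡⟨ cong₂ _++_ (drop-applyUpTo f j≤n) (take-applyUpTo f j≤n) ⟩
  applyUpTo g (n ∸ j) ++ applyUpTo f j
    ≡⟨ cong (applyUpTo g (n ∸ j) ++_) (applyUpTo-cong j (λ r _ → wrap-around r)) ⟩
  applyUpTo g (n ∸ j) ++ applyUpTo (λ r → g (n ∸ j + r)) j
    ≡⟨ applyUpTo-++ g (n ∸ j) j ⟩
  applyUpTo g (n ∸ j + j)
    ≡⟨ cong (applyUpTo g) (m∸n+n≡m j≤n) ⟩
  applyUpTo g n
    ≡⟨ applyUpTo-cong n (λ r _ → cong u (sym (+-assoc p j r))) ⟩
  factor u (p + j) n ∎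
  where
  open ≡-Reasoning
  f g : ℕ → Bool
  f r = u (p + r)
  g r = f (j + r)
  wrap-around : ∀ r → f r ≡ g (n ∸ j + r)
  wrap-around r = sym (trans (cong u (begin
    p + (j + (n ∸ j + r)) ≡⟨ cong (p +_) (+-assoc j (n ∸ j) r) ⟨
    p + (j + (n ∸ j) + r) ≡⟨ cong (λ x → p + (x + r)) (m+[n∸m]≡n j≤n) ⟩
    p + (n + r)           ≡⟨ cong (p +_) (+-comm n r) ⟩
    p + (r + n)           ≡⟨ +-assoc p r n ⟨
    p + r + n             ∎)) (periodic (p + r)))

cyclicShift-1-injective : ∀ {f g : Frame} → cyclicShift 1 f ≡ cyclicShift 1 g → f ≡ g
cyclicShift-1-injective {[]}    {[]}    _  = refl
cyclicShift-1-injective {[]}    {y ∷ g} eq with () ← ++-conicalʳ g (y ∷ []) (sym eq)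
cyclicShift-1-injective {x ∷ f} {[]}    eq with () ← ++-conicalʳ f (x ∷ []) eq
cyclicShift-1-injective {x ∷ f} {y ∷ g} eq with f≡g , refl ← ∷ʳ-injective f g eq = cong (x ∷_) f≡g

_≟ᶠ_ : (f g : Frame) → Dec (f ≡ g)
_≟ᶠ_ = ≡-dec Bool._≟_

count : Frame → List Frame → ℕ
count g fs = length (filter (_≟ᶠ g) fs)

length-filter-map : ∀ {A : Set} (h : A → Frame) g xs →
                    length (filter (λ x → h x ≟ᶠ g) xs) ≡ count g (map h xs)
length-filter-map h g []       = refl
length-filter-map h g (x ∷ xs) with h x ≟ᶠ g
... | yes _ = cong suc (length-filter-map h g xs)
... | no  _ = length-filter-map h g xs

count-↭ : ∀ g {fs fs′} → fs ↭ fs′ → count g fs ≡ count g fs′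
count-↭ g fs↭fs′ = ↭-length (filter-↭ (_≟ᶠ g) fs↭fs′)

count-map-injective : ∀ (h : Frame → Frame) → (∀ {f f′} → h f ≡ h f′ → f ≡ f′) →
                      ∀ g fs → count (h g) (map h fs) ≡ count g fs
count-map-injective h h-inj g []       = refl
count-map-injective h h-inj g (f ∷ fs) with h f ≟ᶠ h g | f ≟ᶠ g
... | yes _  | yes _    = cong suc (count-map-injective h h-inj g fs)
... | no  _  | no  _    = count-map-injective h h-inj g fs
... | yes eq | no  f≢g  = ⊥-elim (f≢g (h-inj eq))
... | no  ne | yes refl = ⊥-elim (ne refl)

-- Factors at consecutive positions are cyclic shifts of each other, and
-- position L wraps to 0, so shifting the target frame permutes the list.
count-factors-shift-invariant :
  ∀ (u : ℕ → Bool) {n L} → 1 ≤ n → (∀ t → u (t + n) ≡ u t) → (∀ t → u (t + L) ≡ u t) →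
  ∀ j → count (factor u j n) (applyUpTo (λ i → factor u i n) L)
      ≡ count (factor u 0 n) (applyUpTo (λ i → factor u i n) L)
count-factors-shift-invariant u {n} {L} 1≤n n-periodic L-periodic = invariant
  where
  F : ℕ → Frame
  F i = factor u i n
  Fs : List Frame
  Fs = applyUpTo F L
  F-suc : ∀ i → cyclicShift 1 (F i) ≡ F (suc i)
  F-suc i = trans (cyclicShift-factor u n-periodic i 1≤n) (cong F (+-comm i 1))
  shift-permutes : map (cyclicShift 1) Fs ↭ Fs
  shift-permutes = begin
    map (cyclicShift 1) Fs          ≡⟨ map-applyUpTo F (cyclicShift 1) L ⟩
    applyUpTo (cyclicShift 1 ∘ F) L ≡⟨ applyUpTo-cong L (λ i _ → F-suc i) ⟩
    applyUpTo (F ∘ suc) L           ↭⟨ applyUpTo-rotate F L F-wraps ⟩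
    Fs                              ∎
    where
    open PermutationReasoning
    F-wraps : F L ≡ F 0
    F-wraps = applyUpTo-cong n (λ r _ → trans (cong u (+-comm L r)) (L-periodic r))
  invariant : ∀ j → count (F j) Fs ≡ count (F 0) Fs
  invariant zero    = refl
  invariant (suc j) = begin
    count (F (suc j)) Fs                                 ≡⟨ cong (λ g → count g Fs) (F-suc j) ⟨
    count (cyclicShift 1 (F j)) Fs                       ≡⟨ count-↭ _ shift-permutes ⟨
    count (cyclicShift 1 (F j)) (map (cyclicShift 1) Fs) ≡⟨ count-map-injective _ cyclicShift-1-injective (F j) Fs ⟩
    count (F j) Fs                                       ≡⟨ invariant j ⟩
    count (F 0) Fs                                       ∎
    where open ≡-Reasoning

CoversAt : ∀ {k} → (ℕ → Maybe (Fin k)) → ℕ → ℕ → (ℕ → Fin k) → Set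
CoversAt c n j g = ∀ r → r < n → Compatible (c (j + r)) (g r)

-- Positions covering the same word are congruent mod L; this is recorded
-- through its consequence that the partial word reads the same from both.
record UniversalCycle (k n L : ℕ) (c : ℕ → Maybe (Fin k)) : Set where
  field
    periodic      : ∀ p → c (p + L) ≡ c p
    covered       : ∀ g → ∃ λ j → CoversAt c n j g
    covers-unique : ∀ {g j j′} → CoversAt c n j g → CoversAt c n j′ g → ∀ d → c (j + d) ≡ c (j′ + d)

fill : ∀ {k} → Fin k → Maybe (Fin k) → Fin k
fill a nothing  = a
fill _ (just b) = b

compatible-fill : ∀ {k} (a : Fin k) x → Compatible x (fill a x)
compatible-fill a nothing  = tt
compatible-fill a (just b) = refl

another-letter : ∀ {k} (b : Fin (suc (suc k))) → ∃ λ a → a ≢ b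
another-letter zero    = suc zero , λ ()
another-letter (suc b) = zero , λ ()

frameChar-no-letters : (x : Maybe (Fin 0)) → frameChar x ≡ false
frameChar-no-letters nothing = refl

module _ {k m M : ℕ} {c : ℕ → Maybe (Fin (suc (suc k)))}
         (U : UniversalCycle (suc (suc k)) (suc m) (suc M) c) where
  open UniversalCycle U

  private
    n L : ℕ
    n = suc m
    L = suc M

    +-exchange-suc : ∀ a b d → a + b + suc d ≡ a + d + suc b
    +-exchange-suc = solve-∀

    covers-update : ∀ {j v a} → (∀ r → r < m → Compatible (c (j + r)) (v r)) → Compatible (c (j + m)) a →
                    CoversAt c n j (v [ m ]≔ a)
    covers-update {j} {v} {a} below at-m r r<n with m≤n⇒m<n∨m≡n (s≤s⁻¹ r<n)
    ... | inj₁ r<m  = subst (Compatible (c (j + r))) (sym ([]≔-unchanged v a (<⇒≢ r<m))) (below r r<m)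
    ... | inj₂ refl = subst (Compatible (c (j + m))) (sym ([]≔-updated v m a)) at-m

  -- For a letter a ≠ b, a filling of c[t+1 .. t+n-1] followed by a is
  -- covered at some j; sliding it one step to the left gives a word covered
  -- both at j - 1 and at t, which forces c (j + m) = c (t + n) = b.
  wildcard-then-letter-impossible : ∀ {t b} → c t ≡ nothing → c (t + n) ≡ just b → ⊥
  wildcard-then-letter-impossible {t} {b} ct≡◇ ct+n≡b = a≢b (sym b≡a)
    where
    a : Fin (suc (suc k))
    a = proj₁ (another-letter b)
    a≢b : a ≢ b
    a≢b = proj₂ (another-letter b)
    v : ℕ → Fin (suc (suc k))
    v r = fill zero (c (suc t + r))
    Y : ℕ → Fin (suc (suc k))
    Y = v [ m ]≔ a
    j : ℕ
    j = proj₁ (covered Y)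
    Y-at-j : CoversAt c n j Y
    Y-at-j = proj₂ (covered Y)
    Z : ℕ → Fin (suc (suc k))
    Z zero    = fill zero (c (j + M))
    Z (suc r) = v r
    Z-at-t : CoversAt c n t Z
    Z-at-t zero    _ = subst (λ x → Compatible x (Z 0)) (sym (trans (cong c (+-identityʳ t)) ct≡◇)) tt
    Z-at-t (suc r) _ = subst (λ p → Compatible (c p) (v r)) (sym (+-suc t r)) (compatible-fill zero _)
    Z-at-pred : CoversAt c n (j + M) Z
    Z-at-pred zero    _         = subst (λ p → Compatible (c p) (Z 0)) (sym (+-identityʳ _)) (compatible-fill zero _)
    Z-at-pred (suc r) (s≤s r<m) = subst₂ Compatible
      (trans (sym (periodic (j + r))) (cong c (+-exchange-suc j r M)))
      ([]≔-unchanged v a (<⇒≢ r<m))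
      (Y-at-j r (m<n⇒m<1+n r<m))
    b≡a : b ≡ a
    b≡a = subst₂ Compatible
      (begin
        c (j + m)         ≡⟨ periodic (j + m) ⟨
        c (j + m + L)     ≡⟨ cong c (+-exchange-suc j m M) ⟩
        c (j + M + n)     ≡⟨ covers-unique Z-at-pred Z-at-t n ⟩
        c (t + n)         ≡⟨ ct+n≡b ⟩
        just b            ∎)
      ([]≔-updated v m a)
      (Y-at-j m ≤-refl)
      where open ≡-Reasoning

  -- Mirror image of the previous argument: slide one step to the right.
  letter-then-wildcard-impossible : ∀ {t b} → c t ≡ just b → c (t + n) ≡ nothing → ⊥
  letter-then-wildcard-impossible {t} {b} ct≡b ct+n≡◇ = a≢b (sym b≡a)
    where
    a : Fin (suc (suc k))
    a = proj₁ (another-letter b)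
    a≢b : a ≢ b
    a≢b = proj₂ (another-letter b)
    v : ℕ → Fin (suc (suc k))
    v r = fill zero (c (suc t + r))
    Y : ℕ → Fin (suc (suc k))
    Y zero    = a
    Y (suc r) = v r
    j : ℕ
    j = proj₁ (covered Y)
    Y-at-j : CoversAt c n j Y
    Y-at-j = proj₂ (covered Y)
    Z : ℕ → Fin (suc (suc k))
    Z = v [ m ]≔ fill zero (c (j + n))
    Z-at-succ-j : CoversAt c n (suc j) Z
    Z-at-succ-j = covers-update
      (λ r r<m → subst (λ p → Compatible (c p) (v r)) (+-suc j r) (Y-at-j (suc r) (s≤s r<m)))
      (subst (λ p → Compatible (c p) (fill zero (c (j + n)))) (+-suc j m) (compatible-fill zero _))
    Z-at-succ-t : CoversAt c n (suc t) Z
    Z-at-succ-t = covers-update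
      (λ r _ → compatible-fill zero _)
      (subst (λ x → Compatible x (fill zero (c (j + n)))) (sym (trans (cong c (sym (+-suc t m))) ct+n≡◇)) tt)
    b≡a : b ≡ a
    b≡a = subst (λ x → Compatible x a)
      (begin
        c (j + 0)      ≡⟨ cong c (+-identityʳ j) ⟩
        c j            ≡⟨ periodic j ⟨
        c (j + L)      ≡⟨ cong c (+-suc j M) ⟩
        c (suc j + M)  ≡⟨ covers-unique Z-at-succ-j Z-at-succ-t M ⟩
        c (suc t + M)  ≡⟨ cong c (+-suc t M) ⟨
        c (t + L)      ≡⟨ periodic t ⟩
        c t            ≡⟨ ct≡b ⟩
        just b         ∎)
      (Y-at-j 0 (s≤s z≤n))
      where open ≡-Reasoning

  frames-periodic-≥2 : ∀ t → frameChar (c (t + n)) ≡ frameChar (c t)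
  frames-periodic-≥2 t with c t in ct | c (t + n) in ct+n
  ... | just _  | just _  = refl
  ... | nothing | nothing = refl
  ... | nothing | just _  = ⊥-elim (wildcard-then-letter-impossible ct ct+n)
  ... | just _  | nothing = ⊥-elim (letter-then-wildcard-impossible ct ct+n)

frames-periodic : ∀ {k m M c} → UniversalCycle k (suc m) (suc M) c →
                  ∀ t → frameChar (c (t + suc m)) ≡ frameChar (c t)
frames-periodic {zero}         {c = c} _ t =
  trans (frameChar-no-letters (c (t + _))) (sym (frameChar-no-letters (c t)))
frames-periodic {suc zero} {m} {c = c} U t = cong frameChar (step-invariant⇒constant c step t _)
  where
  every-position-covers : ∀ j → CoversAt c (suc m) j (λ _ → zero)
  every-position-covers j r _ with c (j + r)
  ... | just zero = refl
  ... | nothing   = tt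
  step : ∀ t → c (suc t) ≡ c t
  step t = sym (trans (cong c (sym (+-identityʳ t)))
    (trans (UniversalCycle.covers-unique U (every-position-covers t) (every-position-covers (suc t)) 0)
           (cong c (+-identityʳ (suc t)))))
frames-periodic {suc (suc k)}          U t = frames-periodic-≥2 U t

module PseudocyclicWord {k m : ℕ} (w : PartialWord k) (n≤N : suc m ≤ length w)
                        (pseudocyclic : Pseudocyclic (suc m) w) where

  n N M L : ℕ
  n = suc m
  N = length w
  M = N ∸ n
  L = suc M

  N≡M+n : N ≡ M + n
  N≡M+n = sym (m∸n+n≡m n≤N)

  N≡L+m : N ≡ L + m
  N≡L+m = trans N≡M+n (+-suc M m)

  <L⇒fits : ∀ {i} → i < L → i + n ≤ N
  <L⇒fits {i} (s≤s i≤M) = subst (i + n ≤_) (sym N≡M+n) (+-monoˡ-≤ n i≤M)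

  letterAt : ℕ → Maybe (Fin k)
  letterAt = lookupOr nothing w

  letterAt-periodic : ∀ q → L + q < N → letterAt (L + q) ≡ letterAt q
  letterAt-periodic q L+q<N = begin
    letterAt (L + q)                   ≡⟨ cong (λ i → letterAt (i + q)) N∸m≡L ⟨
    letterAt (N ∸ m + q)               ≡⟨ lookupOr-drop nothing (N ∸ m) w q ⟨
    lookupOr nothing (drop (N ∸ m) w) q ≡⟨ cong (λ xs → lookupOr nothing xs q) pseudocyclic ⟨
    lookupOr nothing (take m w) q      ≡⟨ lookupOr-take nothing w q<m ⟩
    letterAt q                         ∎
    where
    open ≡-Reasoning
    N∸m≡L : N ∸ m ≡ L
    N∸m≡L = trans (cong (_∸ m) N≡L+m) (m+n∸n≡m L m)
    q<m : q < m
    q<m = +-cancelˡ-< L q m (subst (L + q <_) N≡L+m L+q<N)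

  -- Pseudocyclicity makes every window of w a factor of this cyclic word.
  cyclic : ℕ → Maybe (Fin k)
  cyclic p = letterAt (p % L)

  cyclic-shift-mod : ∀ a b → a % L ≡ b % L → ∀ d → cyclic (a + d) ≡ cyclic (b + d)
  cyclic-shift-mod a b a≡b d = cong letterAt (begin
    (a + d) % L         ≡⟨ %-distribˡ-+ a d L ⟩
    (a % L + d % L) % L ≡⟨ cong (λ x → (x + d % L) % L) a≡b ⟩
    (b % L + d % L) % L ≡⟨ %-distribˡ-+ b d L ⟨
    (b + d) % L         ∎)
    where open ≡-Reasoning

  cyclic-periodic : ∀ p → cyclic (p + L) ≡ cyclic p
  cyclic-periodic p = cong letterAt ([m+n]%n≡m%n p L)

  window≡factor : ∀ i → i + n ≤ N → window n w i ≡ factor cyclic i n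
  window≡factor i fits = trans (take-drop≡factor nothing i w fits)
    (applyUpTo-cong {f = λ r → letterAt (i + r)} {g = λ r → cyclic (i + r)} n λ r r<n →
    periodic-below⇒mod letterAt L N letterAt-periodic (i + r) (<-≤-trans (+-monoʳ-< i r<n) fits))

  universalCycle : Universal n w → UniversalCycle k n L cyclic
  universalCycle U = record
    { periodic      = cyclic-periodic
    ; covered       = covered
    ; covers-unique = λ {g j j′} → covers-unique {g} {j} {j′}
    }
    where
    covers⇒coversAt : ∀ {g i} → Covers w (toVec g n) i → CoversAt cyclic n i g
    covers⇒coversAt {g} {i} (fits , pw) = Pointwise-applyUpTo⁻ n
      (subst₂ (Pointwise Compatible) (window≡factor i fits) (toList-toVec g n) pw)

    coversAt⇒covers : ∀ {g j} → CoversAt cyclic n j g → Covers w (toVec g n) (j % L)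
    coversAt⇒covers {g} {j} cov = fits ,
      subst₂ (Pointwise Compatible) (sym (window≡factor _ fits)) (sym (toList-toVec g n))
        (Pointwise-applyUpTo⁺ n λ r r<n →
          subst (λ x → Compatible x (g r)) (cyclic-shift-mod j (j % L) (sym (m%n%n≡m%n j L)) r) (cov r r<n))
      where
      fits : j % L + n ≤ N
      fits = <L⇒fits (m%n<n j L)

    covered : ∀ g → ∃ λ j → CoversAt cyclic n j g
    covered g with U (toVec g n)
    ... | i , cov , _ = i , covers⇒coversAt cov

    covers-unique : ∀ {g j j′} → CoversAt cyclic n j g → CoversAt cyclic n j′ g →
                    ∀ d → cyclic (j + d) ≡ cyclic (j′ + d)
    covers-unique {g} {j} {j′} cov cov′ with U (toVec g n)
    ... | _ , _ , unique = cyclic-shift-mod j j′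
      (trans (unique (j % L) (coversAt⇒covers {j = j} cov)) (sym (unique (j′ % L) (coversAt⇒covers {j = j′} cov′))))

  frameAt : ℕ → Bool
  frameAt p = frameChar (cyclic p)

  windowFrame≡factor : ∀ i → i < L → windowFrame n w i ≡ factor frameAt i n
  windowFrame≡factor i i<L =
    trans (cong frame (window≡factor i (<L⇒fits i<L))) (map-applyUpTo (λ r → cyclic (i + r)) frameChar n)

  occurrences≡count : ∀ g → occurrences n w g ≡ count g (applyUpTo (λ i → factor frameAt i n) L)
  occurrences≡count g = begin
    occurrences n w g                         ≡⟨ length-filter-map (windowFrame n w) g (upTo L) ⟩
    count g (map (windowFrame n w) (upTo L)) ≡⟨ cong (count g) (map-upTo (windowFrame n w) L) ⟩
    count g (applyUpTo (windowFrame n w) L)  ≡⟨ cong (count g) (applyUpTo-cong L windowFrame≡factor) ⟩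
    count g (applyUpTo (λ i → factor frameAt i n) L) ∎
    where open ≡-Reasoning

  module WithPeriodicFrames (frameAt-periodic : ∀ t → frameAt (t + n) ≡ frameAt t) where

    shifted-first-frame : ∀ {j} → j ≤ n → cyclicShift j (windowFrame n w 0) ≡ factor frameAt j n
    shifted-first-frame {j} j≤n = trans (cong (cyclicShift j) (windowFrame≡factor 0 (s≤s z≤n)))
                                    (cyclicShift-factor frameAt frameAt-periodic 0 j≤n)

    cyclicShift-occurs : ∀ j → j < n → ∃ λ i → (i + n ≤ N) × (windowFrame n w i ≡ cyclicShift j (windowFrame n w 0))
    cyclicShift-occurs j j<n = j % L , <L⇒fits j%L<L , (begin
      windowFrame n w (j % L)          ≡⟨ windowFrame≡factor (j % L) j%L<L ⟩
      factor frameAt (j % L) n         ≡⟨ applyUpTo-cong n (λ r _ → cong frameChar (cyclic-shift-mod (j % L) j (m%n%n≡m%n j L) r)) ⟩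
      factor frameAt j n               ≡⟨ shifted-first-frame (<⇒≤ j<n) ⟨
      cyclicShift j (windowFrame n w 0) ∎)
      where
      open ≡-Reasoning
      j%L<L : j % L < L
      j%L<L = m%n<n j L

    occurrences-cyclicShift : ∀ j → j < n →
      occurrences n w (cyclicShift j (windowFrame n w 0)) ≡ occurrences n w (windowFrame n w 0)
    occurrences-cyclicShift j j<n = begin
      occurrences n w (cyclicShift j (windowFrame n w 0)) ≡⟨ occurrences≡count _ ⟩
      count (cyclicShift j (windowFrame n w 0)) Fs       ≡⟨ cong (λ g → count g Fs) (shifted-first-frame (<⇒≤ j<n)) ⟩
      count (factor frameAt j n) Fs                     ≡⟨ count-factors-shift-invariant frameAt (s≤s z≤n)
                                                             frameAt-periodic (λ t → cong frameChar (cyclic-periodic t)) j ⟩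
      count (factor frameAt 0 n) Fs                     ≡⟨ cong (λ g → count g Fs) (windowFrame≡factor 0 (s≤s z≤n)) ⟨
      count (windowFrame n w 0) Fs                      ≡⟨ occurrences≡count _ ⟨
      occurrences n w (windowFrame n w 0)               ∎
      where
      open ≡-Reasoning
      Fs : List Frame
      Fs = applyUpTo (λ i → factor frameAt i n) L

lemma4p6 : (k n : ℕ) → 1 ≤ n → (w : PartialWord k) → n ≤ length w →
    Universal n w → Pseudocyclic n w →
    ((j : ℕ) → j < n →
       ∃ λ i → (i + n ≤ length w) × (windowFrame n w i ≡ cyclicShift j (windowFrame n w 0)))
    × ((j j′ : ℕ) → j < n → j′ < n →
       occurrences n w (cyclicShift j (windowFrame n w 0))
         ≡ occurrences n w (cyclicShift j′ (windowFrame n w 0)))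
lemma4p6 k (suc m) _ w n≤N universal pseudocyclic =
  cyclicShift-occurs , λ j j′ j<n j′<n → trans (occurrences-cyclicShift j j<n) (sym (occurrences-cyclicShift j′ j′<n))
  where
  open PseudocyclicWord w n≤N pseudocyclic
  open WithPeriodicFrames (frames-periodic (universalCycle universal))
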